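{- For every positive integer $n$, let $$R_n=\{\omega\in\{1,2\}^*_n \mid \lambda=\lambda(\omega),\ \lambda_1\le n-N_\omega(1),\ N_\omega(1)-1\le d(\lambda)\le N_\omega(1),\ B(\lambda)=\emptyset\}$$ and $$R'_n=\{\omega\in\{1,2\}^*_n \mid \lambda=\lambda(\omega),\ \lambda_1= n-N_\omega(1),\ N_\omega(1)-1\le d(\lambda)\le N_\omega(1),\ B(\lambda)=\emptyset\}.$$ Then $(F_n,R_n)$ and $(F'_n,R'_n)$ are Eulerian pairs.
   Context: $\{1,2\}^*_n$ denotes the set of words of length $n$ on the alphabet $\{1,2\}$ (binary words). For a word $\omega=a_1a_2\cdots a_n$ of positive integers, $\mathrm{des}(\omega)=\#\{i : 1\le i\le n-1,\ a_i>a_{i+1}\}$; and if $x_1\le x_2\le\cdots\le x_n$ is the nondecreasing rearrangement of the letters of $\omega$ (so $\omega$ is written in two-line form with top row $x_1\cdots x_n$ and bottom row $a_1\cdots a_n$), then $\mathrm{exc}(\omega)=\#\{i: a_i>x_i\}$. For finite sets $S,T$ of words, $(S,T)$ is an Eulerian pair if for every integer $j$, $\#\{\omega\in S:\mathrm{des}(\omega)=j\}=\#\{\omega\in T:\mathrm{exc}(\omega)=j\}$. A Fibonacci word is a word on $\{1,2\}$ with no two consecutive $1$'s; $F_n$ is the set of Fibonacci words of length $n$ and $F'_n$ the set of those ending with $1$. $N_\omega(1)$ is the number of $1$'s in $\omega$. For a binary word $\omega$, $\lambda(\omega)$ is the integer partition whose parts are the positive values among the numbers $c_1,\dots,c_{N_\omega(1)}$,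 where $c_r$ is the number of $2$'s to the left of the $r$-th occurrence of $1$ in $\omega$ (parts listed in weakly decreasing order $\lambda_1\ge\lambda_2\ge\cdots\ge\lambda_k>0$, $k=l(\lambda)$; $\lambda_1=0$ if $\lambda$ is empty). The Durfee square size $d(\lambda)$ is the largest integer $i\le l(\lambda)$ with $\lambda_i\ge i$, and $B(\lambda)=(\lambda_{d(\lambda)+1},\ldots,\lambda_k)$. -}

module Defs where

open import Data.Nat using (ℕ; zero; suc; _+_; _∸_; _≤ᵇ_; _≡ᵇ_; _⊔_)
open import Data.Bool using (Bool; true; false; if_then_else_; _∧_; not)
open import Data.List using (List; []; _∷_; _++_; map; filterᵇ; length; reverse; drop; null)
open import Data.Vec using (Vec; []; _∷_; toList)
open import Relation.Binary.PropositionalEquality using (_≡_)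

data Letter : Set where
  one two : Letter

val : Letter → ℕ
val one = 1
val two = 2

_>L_ : Letter → Letter → Bool
a >L b = suc (val b) ≤ᵇ val a

allWords : (n : ℕ) → List (Vec Letter n)
allWords zero = [] ∷ []
allWords (suc n) = map (one ∷_) (allWords n) ++ map (two ∷_) (allWords n)

desL : List Letter → ℕ
desL [] = 0
desL (a ∷ []) = 0
desL (a ∷ b ∷ w) = (if a >L b then 1 else 0) + desL (b ∷ w)

des : ∀ {n} → Vec Letter n → ℕ
des w = desL (toList w)

insert : Letter → List Letter → List Letter
insert a [] = a ∷ []
insert a (b ∷ w) = if a >L b then b ∷ insert a w else a ∷ b ∷ w

sortL : List Letter → List Letter
sortL [] = []
sortL (a ∷ w) = insert a (sortL w)

-- #{i : a_i > x_i} for bottom row a and top row x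
excPairs : List Letter → List Letter → ℕ
excPairs (a ∷ as) (x ∷ xs) = (if a >L x then 1 else 0) + excPairs as xs
excPairs _ _ = 0

exc : ∀ {n} → Vec Letter n → ℕ
exc w = excPairs (toList w) (sortL (toList w))

count : ∀ {A : Set} → (A → Bool) → List A → ℕ
count p xs = length (filterᵇ p xs)

EulerianPair : ∀ {n} → List (Vec Letter n) → List (Vec Letter n) → Set
EulerianPair S T = ∀ (j : ℕ) → count (λ w → des w ≡ᵇ j) S ≡ count (λ w → exc w ≡ᵇ j) T

noOneOneL : List Letter → Bool
noOneOneL (one ∷ one ∷ w) = false
noOneOneL (a ∷ w) = noOneOneL w
noOneOneL [] = true

endsWithOneL : List Letter → Bool
endsWithOneL [] = false
endsWithOneL (one ∷ []) = true
endsWithOneL (two ∷ []) = false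
endsWithOneL (a ∷ b ∷ w) = endsWithOneL (b ∷ w)

F : (n : ℕ) → List (Vec Letter n)
F n = filterᵇ (λ w → noOneOneL (toList w)) (allWords n)

F' : (n : ℕ) → List (Vec Letter n)
F' n = filterᵇ (λ w → noOneOneL (toList w) ∧ endsWithOneL (toList w)) (allWords n)

N1L : List Letter → ℕ
N1L [] = 0
N1L (one ∷ w) = suc (N1L w)
N1L (two ∷ w) = N1L w

-- c_1, ..., c_{N(1)}: number of 2's to the left of each occurrence of 1 (k = 2's seen so far)
cs : ℕ → List Letter → List ℕ
cs k [] = []
cs k (one ∷ w) = k ∷ cs k w
cs k (two ∷ w) = cs (suc k) w

positive : ℕ → Bool
positive zero = false
positive (suc _) = true

-- λ(ω): positive c_r's in weakly decreasing order
-- (the c_r are weakly increasing in r, so reversing sorts them decreasingly)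
lambdaL : List Letter → List ℕ
lambdaL w = reverse (filterᵇ positive (cs 0 w))

-- λ_1 (0 if λ empty)
part1 : List ℕ → ℕ
part1 [] = 0
part1 (x ∷ _) = x

-- Durfee square size: largest i ≤ l(λ) with λ_i ≥ i (0 if none);
-- durfeeFrom i xs scans xs = (λ_i, λ_{i+1}, ...)
durfeeFrom : ℕ → List ℕ → ℕ
durfeeFrom i [] = 0
durfeeFrom i (x ∷ xs) = (if i ≤ᵇ x then i else 0) ⊔ durfeeFrom (suc i) xs

durfee : List ℕ → ℕ
durfee λs = durfeeFrom 1 λs

B : List ℕ → List ℕ
B λs = drop (durfee λs) λs

commonCond : List Letter → Bool
commonCond w = ((N1L w ∸ 1) ≤ᵇ durfee (lambdaL w)) ∧ (durfee (lambdaL w) ≤ᵇ N1L w) ∧ null (B (lambdaL w))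

R : (n : ℕ) → List (Vec Letter n)
R n = filterᵇ (λ w → (part1 (lambdaL (toList w)) ≤ᵇ (n ∸ N1L (toList w))) ∧ commonCond (toList w)) (allWords n)

R' : (n : ℕ) → List (Vec Letter n)
R' n = filterᵇ (λ w → (part1 (lambdaL (toList w)) ≡ᵇ (n ∸ N1L (toList w))) ∧ commonCond (toList w)) (allWords n)

module Submission where

-- Write a nonempty word as a ∷ v (first letter a, tail v) and let b select
-- the ending constraint (b = true: the word must end with 1), so that one
-- argument treats both pairs.
--
-- 1. Both statistics count the 1's of the tail.  For a Fibonacci word every
--    1 after the first letter is preceded by 2, so des (a ∷ v) = N₁(v).  For
--    a word of R_n, after deleting a leading 1 the word starts with at least
--    N₁(v) letters 2 (this is what the Durfee-square conditions say), and then
--    exc (a ∷ v) = N₁(v).  The condition on λ₁ is automatic for R_n (λ₁ never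
--    exceeds the number of 2's) and says "the word ends with 1" for R'_n.
-- 2. Hence both sides count, for each first letter a, the tails v with
--    N₁(v) = j: Fibonacci tails on the left, tails v such that
--    "a ∷ v minus a leading 1" starts with 2^j on the right.
-- 3. These two families of counts agree: both satisfy the Fibonacci
--    recursion in the length, the right-hand one by a Pascal-type identity
--    for words with a prescribed prefix of 2's.

open import Defs
open import Data.Nat using (ℕ; zero; suc; _+_; _∸_; _≤ᵇ_; _≡ᵇ_; _⊔_; _≤_; _<_; z≤n; s≤s)
open import Data.Nat.Properties
open import Data.Bool using (Bool; true; false; if_then_else_; _∧_; not; T)
open import Data.Bool.Properties using (∧-zeroʳ; ∧-identityʳ; ∧-comm)
open import Data.List using (List; []; _∷_; _++_; map; filterᵇ; length; reverse; reverseAcc; drop; null; _∷ʳ_; replicate)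
open import Data.List.Properties using (length-++; length-reverse; unfold-reverse; filter-++; length-filter)
open import Data.Vec using (Vec; []; _∷_; toList)
open import Data.Vec.Properties using (length-toList)
open import Data.Product using (_×_; _,_)
open import Data.Empty using (⊥-elim)
open import Data.Unit using (tt)
open import Function using (_∘_)
open import Relation.Binary.PropositionalEquality
open import Relation.Nullary.Decidable using (T?)

T⇒≡true : ∀ {p} → T p → p ≡ true
T⇒≡true {true} _ = refl

≡true⇒T : ∀ {p} → p ≡ true → T p
≡true⇒T refl = tt

∧-guard : ∀ p {q r} → (p ≡ true → q ≡ r) → p ∧ q ≡ p ∧ r
∧-guard true  q≡r = q≡r refl
∧-guard false q≡r = refl

∧-trueˡ : ∀ {p q} → p ∧ q ≡ true → p ≡ true
∧-trueˡ {true} _ = refl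

≡ᵇ-subst : ∀ (f : ℕ → Bool) m j → f m ∧ (m ≡ᵇ j) ≡ f j ∧ (m ≡ᵇ j)
≡ᵇ-subst f m j with m ≡ᵇ j in eq
... | true  = cong (λ k → f k ∧ true) (≡ᵇ⇒≡ m j (≡true⇒T eq))
... | false = trans (∧-zeroʳ (f m)) (sym (∧-zeroʳ (f j)))

≤ᵇ-true : ∀ {m n} → m ≤ n → (m ≤ᵇ n) ≡ true
≤ᵇ-true m≤n = T⇒≡true (≤⇒≤ᵇ m≤n)

≤ᵇ-false : ∀ {m n} → n < m → (m ≤ᵇ n) ≡ false
≤ᵇ-false {m} {n} n<m with m ≤ᵇ n in eq
... | false = refl
... | true  = ⊥-elim (<⇒≱ n<m (≤ᵇ⇒≤ m n (≡true⇒T eq)))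

≤ᵇ-sound : ∀ {m n} → (m ≤ᵇ n) ≡ true → m ≤ n
≤ᵇ-sound {m} {n} eq = ≤ᵇ⇒≤ m n (≡true⇒T eq)

count-cong : ∀ {A : Set} {p q : A → Bool} (xs : List A) → (∀ x → p x ≡ q x) → count p xs ≡ count q xs
count-cong [] _ = refl
count-cong {p = p} {q} (x ∷ xs) p≗q with p x | q x | p≗q x
... | true  | true  | refl = cong suc (count-cong xs p≗q)
... | false | false | refl = count-cong xs p≗q

count-none : ∀ {A : Set} {p : A → Bool} (xs : List A) → (∀ x → p x ≡ false) → count p xs ≡ 0
count-none [] _ = refl
count-none {p = p} (x ∷ xs) never with p x | never x
... | false | refl = count-none xs never

count-++ : ∀ {A : Set} (p : A → Bool) (xs ys : List A) → count p (xs ++ ys) ≡ count p xs + count p ys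
count-++ p xs ys = trans (cong length (filter-++ (T? ∘ p) xs ys)) (length-++ (filterᵇ p xs))

count-map : ∀ {A B : Set} (p : B → Bool) (f : A → B) (xs : List A) → count p (map f xs) ≡ count (p ∘ f) xs
count-map p f [] = refl
count-map p f (x ∷ xs) with p (f x)
... | true  = cong suc (count-map p f xs)
... | false = count-map p f xs

count-filter : ∀ {A : Set} (p q : A → Bool) (xs : List A) → count q (filterᵇ p xs) ≡ count (λ x → p x ∧ q x) xs
count-filter p q [] = refl
count-filter p q (x ∷ xs) with p x
... | false = count-filter p q xs
... | true with q x
...   | true  = cong suc (count-filter p q xs)
...   | false = count-filter p q xs

wordCount : ℕ → (List Letter → Bool) → ℕ
wordCount n p = count (λ w → p (toList w)) (allWords n)

wordCount-suc : ∀ n (p : List Letter → Bool) →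
  wordCount (suc n) p ≡ wordCount n (λ v → p (one ∷ v)) + wordCount n (λ v → p (two ∷ v))
wordCount-suc n p = begin
    count p′ (map (one ∷_) (allWords n) ++ map (two ∷_) (allWords n))
  ≡⟨ count-++ p′ (map (one ∷_) (allWords n)) (map (two ∷_) (allWords n)) ⟩
    count p′ (map (one ∷_) (allWords n)) + count p′ (map (two ∷_) (allWords n))
  ≡⟨ cong₂ _+_ (count-map p′ (one ∷_) (allWords n)) (count-map p′ (two ∷_) (allWords n)) ⟩
    wordCount n (λ v → p (one ∷ v)) + wordCount n (λ v → p (two ∷ v)) ∎
  where
  open ≡-Reasoning
  p′ : Vec Letter (suc n) → Bool
  p′ w = p (toList w)

wordCount-cong : ∀ n {p q : List Letter → Bool} →
  (∀ (w : Vec Letter n) → p (toList w) ≡ q (toList w)) → wordCount n p ≡ wordCount n q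
wordCount-cong n = count-cong (allWords n)

wordCount-none : ∀ n {p : List Letter → Bool} →
  (∀ (w : Vec Letter n) → p (toList w) ≡ false) → wordCount n p ≡ 0
wordCount-none n = count-none (allWords n)

twoPrefix : ℕ → List Letter → Bool
twoPrefix zero    ω         = true
twoPrefix (suc k) []        = false
twoPrefix (suc k) (one ∷ ω) = false
twoPrefix (suc k) (two ∷ ω) = twoPrefix k ω

-- `lastOK b a v`: the word a ∷ v satisfies the ending constraint
-- "if b then the word ends with 1".  Recursing on v (not on a) makes
-- lastOK b a (x ∷ v) compute to lastOK b x v.
lastOK : Bool → Letter → List Letter → Bool
lastOK b a   (x ∷ v) = lastOK b x v
lastOK b one []      = true
lastOK b two []      = not b

lastOK-unconstrained : ∀ a v → lastOK false a v ≡ true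
lastOK-unconstrained one []      = refl
lastOK-unconstrained two []      = refl
lastOK-unconstrained a   (x ∷ v) = lastOK-unconstrained x v

endsWithOne-lastOK : ∀ a v → endsWithOneL (a ∷ v) ≡ lastOK true a v
endsWithOne-lastOK one []      = refl
endsWithOne-lastOK two []      = refl
endsWithOne-lastOK one (x ∷ v) = endsWithOne-lastOK x v
endsWithOne-lastOK two (x ∷ v) = endsWithOne-lastOK x v

prefixTest : Bool → ℕ → Letter → ℕ → List Letter → Bool
prefixTest b k a j v = (twoPrefix k v ∧ lastOK b a v) ∧ (N1L v ≡ᵇ j)

prefixCount : Bool → ℕ → Letter → ℕ → ℕ → ℕ
prefixCount b k a n j = wordCount n (prefixTest b k a j)

-- A positive prefix forces the first letter to be 2.
prefixCount-suc : ∀ b k a n j → prefixCount b (suc k) a (suc n) j ≡ prefixCount b k two n j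
prefixCount-suc b k a n j =
  trans (wordCount-suc n (prefixTest b (suc k) a j)) (cong (_+ prefixCount b k two n j) (wordCount-none n {prefixTest b (suc k) a j ∘ (one ∷_)} (λ _ → refl)))

-- With no 1 allowed, the first letter is 2.
prefixCount-noOnes : ∀ b a n → prefixCount b 0 a (suc n) 0 ≡ prefixCount b 0 two n 0
prefixCount-noOnes b a n =
  trans (wordCount-suc n (prefixTest b 0 a 0))
        (cong (_+ prefixCount b 0 two n 0) (wordCount-none n {prefixTest b 0 a 0 ∘ (one ∷_)}
                                                    (λ w → ∧-zeroʳ (lastOK b one (toList w)))))

-- The empty tail has no 1.
prefixCount-empty : ∀ b k a j → prefixCount b k a 0 (suc j) ≡ 0
prefixCount-empty b k a j = wordCount-none 0 {prefixTest b k a (suc j)} (λ { [] → ∧-zeroʳ (twoPrefix k [] ∧ lastOK b a []) })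

-- The letter in front of a tail only matters for the ending of the empty tail.
prefixCount-front : ∀ b k a a′ n j → prefixCount b k a n (suc j) ≡ prefixCount b k a′ n (suc j)
prefixCount-front b k a a′ zero    j = trans (prefixCount-empty b k a j) (sym (prefixCount-empty b k a′ j))
prefixCount-front b k a a′ (suc n) j =
  trans (wordCount-suc n (prefixTest b k a (suc j))) (sym (wordCount-suc n (prefixTest b k a′ (suc j))))

-- Pascal's rule for words with prefix 2^k, splitting off the first letter
-- after the prefix: C(n+1-k, j+1) = C(n-k, j) + C(n-k, j+1), as long as k ≤ j.
prefixCount-pascal : ∀ b k a n j → k ≤ j →
  prefixCount b k a (suc n) (suc j) ≡ prefixCount b k one n j + prefixCount b k two n (suc j)
prefixCount-pascal b zero a n j _ = wordCount-suc n (prefixTest b 0 a (suc j))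
prefixCount-pascal b (suc k) a zero (suc j) _ =
  trans (prefixCount-suc b k a 0 (suc (suc j))) (prefixCount-empty b k two (suc j))
prefixCount-pascal b (suc k) a (suc n) (suc j) (s≤s k≤j) = begin
    prefixCount b (suc k) a (suc (suc n)) (suc (suc j))
  ≡⟨ prefixCount-suc b k a (suc n) (suc (suc j)) ⟩
    prefixCount b k two (suc n) (suc (suc j))
  ≡⟨ prefixCount-pascal b k two n (suc j) (m≤n⇒m≤1+n k≤j) ⟩
    prefixCount b k one n (suc j) + prefixCount b k two n (suc (suc j))
  ≡⟨ cong (_+ prefixCount b k two n (suc (suc j))) (prefixCount-front b k one two n j) ⟩
    prefixCount b k two n (suc j) + prefixCount b k two n (suc (suc j))
  ≡⟨ sym (cong₂ _+_ (prefixCount-suc b k one n (suc j)) (prefixCount-suc b k two n (suc (suc j)))) ⟩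
    prefixCount b (suc k) one (suc n) (suc j) + prefixCount b (suc k) two (suc n) (suc (suc j)) ∎
  where open ≡-Reasoning

fibTest : Bool → Letter → ℕ → List Letter → Bool
fibTest b a j v = (noOneOneL (a ∷ v) ∧ lastOK b a v) ∧ (N1L v ≡ᵇ j)

fibCount : Bool → Letter → ℕ → ℕ → ℕ
fibCount b a n j = wordCount n (fibTest b a j)

-- The Fibonacci recursion: after a 1 comes a 2, after a 2 anything.
fibCount-one : ∀ b n j → fibCount b one (suc n) j ≡ fibCount b two n j
fibCount-one b n j =
  trans (wordCount-suc n (fibTest b one j))
        (cong (_+ fibCount b two n j) (wordCount-none n {fibTest b one j ∘ (one ∷_)} (λ _ → refl)))

fibCount-two-zero : ∀ b n → fibCount b two (suc n) 0 ≡ fibCount b two n 0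
fibCount-two-zero b n =
  trans (wordCount-suc n (fibTest b two 0))
        (cong (_+ fibCount b two n 0) (wordCount-none n {fibTest b two 0 ∘ (one ∷_)}
                                                         (λ w → ∧-zeroʳ (noOneOneL (one ∷ toList w) ∧ lastOK b one (toList w)))))

fibCount-two-suc : ∀ b n j → fibCount b two (suc n) (suc j) ≡ fibCount b one n j + fibCount b two n (suc j)
fibCount-two-suc b n j = wordCount-suc n (fibTest b two (suc j))

stripOne : Letter → List Letter → List Letter
stripOne one v = v
stripOne two v = two ∷ v

shapeTest : Bool → Letter → ℕ → List Letter → Bool
shapeTest b a j v = (twoPrefix j (stripOne a v) ∧ lastOK b a v) ∧ (N1L v ≡ᵇ j)

shapeCount : Bool → Letter → ℕ → ℕ → ℕ
shapeCount b a n j = wordCount n (shapeTest b a j)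

shapeCount-one : ∀ b n j → shapeCount b two n j ≡ shapeCount b one (suc n) j
shapeCount-one b n zero    = sym (prefixCount-noOnes b one n)
shapeCount-one b n (suc j) = sym (prefixCount-suc b j one n (suc j))

fib≡shape : ∀ b a n j → fibCount b a n j ≡ shapeCount b a n j
fib≡shape b a zero j = wordCount-cong 0 {fibTest b a j} {shapeTest b a j} (λ { [] → emptyTail a j })
  where
  emptyTail : ∀ a j → fibTest b a j [] ≡ shapeTest b a j []
  emptyTail one zero    = refl
  emptyTail two zero    = refl
  emptyTail a   (suc j) = trans (∧-zeroʳ (noOneOneL (a ∷ []) ∧ lastOK b a []))
                                (sym (∧-zeroʳ (twoPrefix (suc j) (stripOne a []) ∧ lastOK b a [])))
fib≡shape b one (suc n) j =
  trans (fibCount-one b n j) (trans (fib≡shape b two n j) (shapeCount-one b n j))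
fib≡shape b two (suc n) zero =
  trans (fibCount-two-zero b n) (trans (fib≡shape b two n 0) (sym (prefixCount-noOnes b two n)))
fib≡shape b two (suc n) (suc j) = begin
    fibCount b two (suc n) (suc j)
  ≡⟨ fibCount-two-suc b n j ⟩
    fibCount b one n j + fibCount b two n (suc j)
  ≡⟨ cong₂ _+_ (fib≡shape b one n j) (fib≡shape b two n (suc j)) ⟩
    prefixCount b j one n j + prefixCount b j two n (suc j)
  ≡⟨ sym (prefixCount-pascal b j two n j ≤-refl) ⟩
    shapeCount b two (suc n) (suc j) ∎
  where open ≡-Reasoning

-- In a Fibonacci word every 1 after the first letter follows a 2 and so
-- closes a descent 21; these are all the descents.
des-fibonacci : ∀ a v → noOneOneL (a ∷ v) ≡ true → desL (a ∷ v) ≡ N1L v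
des-fibonacci a   []        _   = refl
des-fibonacci one (one ∷ v) ()
des-fibonacci two (one ∷ v) fib = cong suc (des-fibonacci one v fib)
des-fibonacci one (two ∷ v) fib = des-fibonacci two v fib
des-fibonacci two (two ∷ v) fib = des-fibonacci two v fib

fibOK : Bool → List Letter → Bool
fibOK false ω = noOneOneL ω
fibOK true  ω = noOneOneL ω ∧ endsWithOneL ω

Fib : Bool → (n : ℕ) → List (Vec Letter n)
Fib b n = filterᵇ (λ w → fibOK b (toList w)) (allWords n)

fibOK-lastOK : ∀ b a v → fibOK b (a ∷ v) ≡ noOneOneL (a ∷ v) ∧ lastOK b a v
fibOK-lastOK false a v = trans (sym (∧-identityʳ _)) (cong (noOneOneL (a ∷ v) ∧_) (sym (lastOK-unconstrained a v)))
fibOK-lastOK true  a v = cong (noOneOneL (a ∷ v) ∧_) (endsWithOne-lastOK a v)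

fib-test : ∀ b a j v → fibOK b (a ∷ v) ∧ (desL (a ∷ v) ≡ᵇ j) ≡ fibTest b a j v
fib-test b a j v = trans (cong (_∧ (desL (a ∷ v) ≡ᵇ j)) (fibOK-lastOK b a v))
  (∧-guard (noOneOneL (a ∷ v) ∧ lastOK b a v) (λ ok → cong (_≡ᵇ j) (des-fibonacci a v (∧-trueˡ ok))))

fib-side : ∀ b n j → count (λ w → des w ≡ᵇ j) (Fib b (suc n)) ≡ shapeCount b one n j + shapeCount b two n j
fib-side b n j = begin
    count (λ w → des w ≡ᵇ j) (Fib b (suc n))
  ≡⟨ count-filter _ _ (allWords (suc n)) ⟩
    wordCount (suc n) desTest
  ≡⟨ wordCount-suc n desTest ⟩
    wordCount n (desTest ∘ (one ∷_)) + wordCount n (desTest ∘ (two ∷_))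
  ≡⟨ cong₂ _+_ (wordCount-cong n {desTest ∘ (one ∷_)} {fibTest b one j} (λ w → fib-test b one j (toList w)))
               (wordCount-cong n {desTest ∘ (two ∷_)} {fibTest b two j} (λ w → fib-test b two j (toList w))) ⟩
    fibCount b one n j + fibCount b two n j
  ≡⟨ cong₂ _+_ (fib≡shape b one n j) (fib≡shape b two n j) ⟩
    shapeCount b one n j + shapeCount b two n j ∎
  where
  open ≡-Reasoning
  desTest : List Letter → Bool
  desTest ω = fibOK b ω ∧ (desL ω ≡ᵇ j)

N2L : List Letter → ℕ
N2L []        = 0
N2L (one ∷ ω) = N2L ω
N2L (two ∷ ω) = suc (N2L ω)

length-N1+N2 : ∀ ω → length ω ≡ N1L ω + N2L ω
length-N1+N2 []        = refl
length-N1+N2 (one ∷ ω) = cong suc (length-N1+N2 ω)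
length-N1+N2 (two ∷ ω) = trans (cong suc (length-N1+N2 ω)) (sym (+-suc (N1L ω) (N2L ω)))

length∸N1 : ∀ ω → length ω ∸ N1L ω ≡ N2L ω
length∸N1 ω = trans (cong (_∸ N1L ω) (length-N1+N2 ω)) (m+n∸m≡n (N1L ω) (N2L ω))

-- The top row of the two-line notation is 1^N₁ 2^N₂.
sortL-sorted : ∀ ω → sortL ω ≡ replicate (N1L ω) one ++ replicate (N2L ω) two
sortL-sorted []        = refl
sortL-sorted (one ∷ ω) = trans (cong (insert one) (sortL-sorted ω)) (insert-one (N1L ω) (N2L ω))
  where
  insert-one : ∀ m t → insert one (replicate m one ++ replicate t two) ≡ one ∷ replicate m one ++ replicate t two
  insert-one zero    zero    = refl
  insert-one zero    (suc t) = refl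
  insert-one (suc m) t       = refl
sortL-sorted (two ∷ ω) = trans (cong (insert two) (sortL-sorted ω)) (insert-two (N1L ω) (N2L ω))
  where
  insert-two : ∀ m t → insert two (replicate m one ++ replicate t two) ≡ replicate m one ++ two ∷ replicate t two
  insert-two zero    zero    = refl
  insert-two zero    (suc t) = refl
  insert-two (suc m) t       = cong (one ∷_) (insert-two m t)

excPairs-twos : ∀ v t → excPairs v (replicate t two) ≡ 0
excPairs-twos []        t       = refl
excPairs-twos (a ∷ v)   zero    = refl
excPairs-twos (one ∷ v) (suc t) = excPairs-twos v t
excPairs-twos (two ∷ v) (suc t) = excPairs-twos v t

excPairs-prefix : ∀ m v t → twoPrefix m v ≡ true → excPairs v (replicate m one ++ replicate t two) ≡ m
excPairs-prefix zero    v         t _      = excPairs-twos v t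
excPairs-prefix (suc m) (two ∷ v) t prefix = cong suc (excPairs-prefix m v t prefix)

exc-shape : ∀ a v → twoPrefix (N1L v) (stripOne a v) ≡ true → excPairs (a ∷ v) (sortL (a ∷ v)) ≡ N1L v
exc-shape one v prefix rewrite sortL-sorted (one ∷ v) = excPairs-prefix (N1L v) v (N2L v) prefix
exc-shape two v prefix rewrite sortL-sorted (two ∷ v) = excPairs-prefix (N1L v) (two ∷ v) (suc (N2L v)) prefix

-- λ(ω) only sees the 1's after the first 2: leading 1's contribute c = 0,
-- and after a 2 every c is positive.
cs-positive : ∀ k u → filterᵇ positive (cs (suc k) u) ≡ cs (suc k) u
cs-positive k []        = refl
cs-positive k (one ∷ u) = cong (suc k ∷_) (cs-positive k u)
cs-positive k (two ∷ u) = cs-positive (suc k) u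

lambda-two : ∀ u → lambdaL (two ∷ u) ≡ reverse (cs 1 u)
lambda-two u = cong reverse (cs-positive 0 u)

length-cs : ∀ k u → length (cs k u) ≡ N1L u
length-cs k []        = refl
length-cs k (one ∷ u) = cong suc (length-cs k u)
length-cs k (two ∷ u) = length-cs (suc k) u

length-lambda : ∀ u → length (lambdaL u) ≤ N1L u
length-lambda u = begin
    length (reverse (filterᵇ positive (cs 0 u)))
  ≡⟨ length-reverse (filterᵇ positive (cs 0 u)) ⟩
    length (filterᵇ positive (cs 0 u))
  ≤⟨ length-filter (T? ∘ positive) (cs 0 u) ⟩
    length (cs 0 u)
  ≡⟨ length-cs 0 u ⟩
    N1L u ∎
  where open ≤-Reasoning

lastOr : ℕ → List ℕ → ℕ
lastOr d []       = d
lastOr d (x ∷ xs) = lastOr x xs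

part1-reverse : ∀ xs → part1 (reverse xs) ≡ lastOr 0 xs
part1-reverse = part1-reverseAcc []
  where
  part1-reverseAcc : ∀ ys xs → part1 (reverseAcc ys xs) ≡ lastOr (part1 ys) xs
  part1-reverseAcc ys []       = refl
  part1-reverseAcc ys (x ∷ xs) = part1-reverseAcc (x ∷ ys) xs

-- The c's read from k (2's already seen) never exceed k + N₂ of the rest;
-- d is the last c seen so far.
cs-last-bound : ∀ d k u → d ≤ k → lastOr d (cs k u) ≤ k + N2L u
cs-last-bound d k []        d≤k = ≤-trans d≤k (m≤m+n k 0)
cs-last-bound d k (one ∷ u) _   = cs-last-bound k k u ≤-refl
cs-last-bound d k (two ∷ u) d≤k rewrite +-suc k (N2L u) = cs-last-bound d (suc k) u (m≤n⇒m≤1+n d≤k)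

-- The last c attains k + N₂ exactly when the word ends with 1.  The last
-- letter read was a 1 precisely when d = k (a 2 was read when d < k).
cs-last-after-two : ∀ d k u → d < k → (lastOr d (cs k u) ≡ᵇ k + N2L u) ≡ lastOK true two u
cs-last-after-one : ∀ k u → (lastOr k (cs k u) ≡ᵇ k + N2L u) ≡ lastOK true one u
cs-last-after-two d k [] d<k with d ≡ᵇ k + 0 in eq
... | false = refl
... | true  = ⊥-elim (<-irrefl (trans (≡ᵇ⇒≡ d (k + 0) (≡true⇒T eq)) (+-identityʳ k)) d<k)
cs-last-after-two d k (one ∷ u) _   = cs-last-after-one k u
cs-last-after-two d k (two ∷ u) d<k rewrite +-suc k (N2L u) = cs-last-after-two d (suc k) u (m<n⇒m<1+n d<k)
cs-last-after-one k [] rewrite +-identityʳ k = T⇒≡true (≡⇒≡ᵇ k k refl)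
cs-last-after-one k (one ∷ u) = cs-last-after-one k u
cs-last-after-one k (two ∷ u) rewrite +-suc k (N2L u) = cs-last-after-two k (suc k) u (n<1+n k)

part1-bound : ∀ ω → part1 (lambdaL ω) ≤ N2L ω
part1-bound []        = z≤n
part1-bound (one ∷ u) = part1-bound u
part1-bound (two ∷ u) rewrite lambda-two u | part1-reverse (cs 1 u) = cs-last-bound 0 1 u z≤n

part1-exact : ∀ a v → (part1 (lambdaL (a ∷ v)) ≡ᵇ N2L (a ∷ v)) ≡ lastOK true a v
part1-exact one []      = refl
part1-exact one (x ∷ v) = part1-exact x v
part1-exact two v rewrite lambda-two v | part1-reverse (cs 1 v) = cs-last-after-two 0 1 v (s≤s z≤n)

partCond : Bool → ℕ → List Letter → Bool
partCond false n ω = part1 (lambdaL ω) ≤ᵇ (n ∸ N1L ω)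
partCond true  n ω = part1 (lambdaL ω) ≡ᵇ (n ∸ N1L ω)

partCond-lastOK : ∀ b a v → partCond b (length (a ∷ v)) (a ∷ v) ≡ lastOK b a v
partCond-lastOK false a v rewrite length∸N1 (a ∷ v) =
  trans (≤ᵇ-true (part1-bound (a ∷ v))) (sym (lastOK-unconstrained a v))
partCond-lastOK true  a v rewrite length∸N1 (a ∷ v) = part1-exact a v

durfee-bound : ∀ i xs → durfeeFrom (suc i) xs ≤ i + length xs
durfee-bound i []       = z≤n
durfee-bound i (x ∷ xs) = ⊔-lub this (≤-trans (durfee-bound (suc i) xs) (≤-reflexive (sym (+-suc i (length xs)))))
  where
  this : (if suc i ≤ᵇ x then suc i else 0) ≤ i + suc (length xs)
  this with suc i ≤ᵇ x
  ... | true  = ≤-trans (s≤s (m≤m+n i (length xs))) (≤-reflexive (sym (+-suc i (length xs))))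
  ... | false = z≤n

durfeeFrom-++ : ∀ i xs zs → durfeeFrom i (xs ++ zs) ≡ durfeeFrom i xs ⊔ durfeeFrom (i + length xs) zs
durfeeFrom-++ i []       zs = cong (λ k → durfeeFrom k zs) (sym (+-identityʳ i))
durfeeFrom-++ i (x ∷ xs) zs = begin
    here ⊔ durfeeFrom (suc i) (xs ++ zs)
  ≡⟨ cong (here ⊔_) (durfeeFrom-++ (suc i) xs zs) ⟩
    here ⊔ (durfeeFrom (suc i) xs ⊔ durfeeFrom (suc i + length xs) zs)
  ≡⟨ sym (⊔-assoc here (durfeeFrom (suc i) xs) _) ⟩
    (here ⊔ durfeeFrom (suc i) xs) ⊔ durfeeFrom (suc i + length xs) zs
  ≡⟨ cong (λ k → (here ⊔ durfeeFrom (suc i) xs) ⊔ durfeeFrom k zs) (sym (+-suc i (length xs))) ⟩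
    durfeeFrom i (x ∷ xs) ⊔ durfeeFrom (i + length (x ∷ xs)) zs ∎
  where
  open ≡-Reasoning
  here : ℕ
  here = if i ≤ᵇ x then i else 0

durfee-snoc : ∀ xs y → (suc (length xs) ≤ᵇ durfee (xs ∷ʳ y)) ≡ (suc (length xs) ≤ᵇ y)
durfee-snoc xs y rewrite durfeeFrom-++ 1 xs (y ∷ []) = full (durfee-bound 0 xs)
  where
  L = length xs
  full : ∀ {d} → d ≤ L → (suc L ≤ᵇ (d ⊔ ((if suc L ≤ᵇ y then suc L else 0) ⊔ 0))) ≡ (suc L ≤ᵇ y)
  full {d} d≤L with suc L ≤ᵇ y
  ... | true  = ≤ᵇ-true (≤-trans (m≤n⊔m 0 (suc L)) (m≤n⊔m d (suc L ⊔ 0)))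
  ... | false = trans (cong (suc L ≤ᵇ_) (⊔-identityʳ d)) (≤ᵇ-false (s≤s d≤L))

null-drop : ∀ d (xs : List ℕ) → null (drop d xs) ≡ (length xs ≤ᵇ d)
null-drop zero    []       = refl
null-drop zero    (x ∷ xs) = refl
null-drop (suc d) []       = refl
null-drop (suc d) (x ∷ xs) = trans (null-drop d xs) (sym (≤ᵇ-suc (length xs) d))
  where
  ≤ᵇ-suc : ∀ m n → (suc m ≤ᵇ suc n) ≡ (m ≤ᵇ n)
  ≤ᵇ-suc zero    n = refl
  ≤ᵇ-suc (suc m) n = refl

durfee-window : ∀ M λs → M ∸ 1 ≤ length λs → length λs ≤ M →
  ((M ∸ 1 ≤ᵇ durfee λs) ∧ (durfee λs ≤ᵇ M) ∧ null (B λs)) ≡ (length λs ≤ᵇ durfee λs)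
durfee-window M λs lower upper rewrite null-drop (durfee λs) λs with length λs ≤ᵇ durfee λs in full
... | false = trans (cong ((M ∸ 1 ≤ᵇ durfee λs) ∧_) (∧-zeroʳ (durfee λs ≤ᵇ M))) (∧-zeroʳ _)
... | true  rewrite ≤ᵇ-true (≤-trans lower (≤ᵇ-sound full))
                  | ≤ᵇ-true (≤-trans (durfee-bound 0 λs) upper) = refl

cs-head-bound : ∀ k u {x xs} → cs k u ≡ x ∷ xs → k ≤ x
cs-head-bound k (one ∷ u) refl = ≤-refl
cs-head-bound k (two ∷ u) eq   = ≤-trans (n≤1+n k) (cs-head-bound (suc k) u eq)

cs-head-prefix : ∀ k t u {x xs} → cs k u ≡ x ∷ xs → (k + t ≤ᵇ x) ≡ twoPrefix t u
cs-head-prefix k zero    (one ∷ u) refl = ≤ᵇ-true (≤-reflexive (+-identityʳ k))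
cs-head-prefix k (suc t) (one ∷ u) refl = ≤ᵇ-false (m<m+n k (s≤s z≤n))
cs-head-prefix k zero    (two ∷ u) eq   =
  ≤ᵇ-true (≤-trans (≤-reflexive (+-identityʳ k)) (≤-trans (n≤1+n k) (cs-head-bound (suc k) u eq)))
cs-head-prefix k (suc t) (two ∷ u) eq rewrite +-suc k t = cs-head-prefix (suc k) t u eq

-- For λ(2u) (parts: the reversed c's of u), the Durfee square fills all
-- N₁(u) rows iff 2u begins with 2^N₁(u), i.e. the smallest part is ≥ N₁(u).
full-durfee-cs : ∀ u → (N1L u ≤ᵇ durfee (reverse (cs 1 u))) ≡ twoPrefix (N1L u) (two ∷ u)
full-durfee-cs u rewrite sym (length-cs 1 u) with cs 1 u in eq
... | []     = refl
... | x ∷ xs = begin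
    suc (length xs) ≤ᵇ durfee (reverse (x ∷ xs))
  ≡⟨ cong (λ zs → suc (length xs) ≤ᵇ durfee zs) (unfold-reverse x xs) ⟩
    suc (length xs) ≤ᵇ durfee (reverse xs ∷ʳ x)
  ≡⟨ cong (λ l → suc l ≤ᵇ durfee (reverse xs ∷ʳ x)) (sym (length-reverse xs)) ⟩
    suc (length (reverse xs)) ≤ᵇ durfee (reverse xs ∷ʳ x)
  ≡⟨ durfee-snoc (reverse xs) x ⟩
    suc (length (reverse xs)) ≤ᵇ x
  ≡⟨ cong (λ l → suc l ≤ᵇ x) (length-reverse xs) ⟩
    suc (length xs) ≤ᵇ x
  ≡⟨ cs-head-prefix 1 (length xs) u eq ⟩
    twoPrefix (length xs) u ∎
  where open ≡-Reasoning

durfee-window-two : ∀ M u → M ∸ 1 ≤ N1L u → N1L u ≤ M →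
  let λs = reverse (cs 1 u) in
  ((M ∸ 1 ≤ᵇ durfee λs) ∧ (durfee λs ≤ᵇ M) ∧ null (B λs)) ≡ twoPrefix (N1L u) (two ∷ u)
durfee-window-two M u lower upper =
  trans (durfee-window M λs (≤-trans lower (≤-reflexive (sym length-λ))) (≤-trans (≤-reflexive length-λ) upper))
        (trans (cong (_≤ᵇ durfee λs) length-λ) (full-durfee-cs u))
  where
  λs = reverse (cs 1 u)
  length-λ : length λs ≡ N1L u
  length-λ = trans (length-reverse (cs 1 u)) (length-cs 1 u)

commonCond-shape : ∀ a v → commonCond (a ∷ v) ≡ twoPrefix (N1L v) (stripOne a v)
commonCond-shape two v rewrite lambda-two v = durfee-window-two (N1L v) v (m∸n≤m (N1L v) 1) ≤-refl
commonCond-shape one [] = refl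
commonCond-shape one (two ∷ u) rewrite lambda-two u = durfee-window-two (suc (N1L u)) u ≤-refl (n≤1+n (N1L u))
commonCond-shape one (one ∷ u)
  rewrite ≤ᵇ-false (s≤s (≤-trans (durfee-bound 0 (lambdaL u)) (length-lambda u))) = refl

rOK : Bool → ℕ → List Letter → Bool
rOK b n ω = partCond b n ω ∧ commonCond ω

Rep : Bool → (n : ℕ) → List (Vec Letter n)
Rep b n = filterᵇ (λ w → rOK b n (toList w)) (allWords n)

r-test : ∀ b a j v → rOK b (length (a ∷ v)) (a ∷ v) ∧ (excPairs (a ∷ v) (sortL (a ∷ v)) ≡ᵇ j) ≡ shapeTest b a j v
r-test b a j v = begin
    (partCond b (length (a ∷ v)) (a ∷ v) ∧ commonCond (a ∷ v)) ∧ (exc′ ≡ᵇ j)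
  ≡⟨ cong₂ (λ p q → (p ∧ q) ∧ (exc′ ≡ᵇ j)) (partCond-lastOK b a v) (commonCond-shape a v) ⟩
    (lastOK b a v ∧ shape (N1L v)) ∧ (exc′ ≡ᵇ j)
  ≡⟨ cong (_∧ (exc′ ≡ᵇ j)) (∧-comm (lastOK b a v) (shape (N1L v))) ⟩
    (shape (N1L v) ∧ lastOK b a v) ∧ (exc′ ≡ᵇ j)
  ≡⟨ ∧-guard (shape (N1L v) ∧ lastOK b a v) (λ ok → cong (_≡ᵇ j) (exc-shape a v (∧-trueˡ ok))) ⟩
    (shape (N1L v) ∧ lastOK b a v) ∧ (N1L v ≡ᵇ j)
  ≡⟨ ≡ᵇ-subst (λ m → shape m ∧ lastOK b a v) (N1L v) j ⟩
    shapeTest b a j v ∎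
  where
  open ≡-Reasoning
  exc′ = excPairs (a ∷ v) (sortL (a ∷ v))
  shape : ℕ → Bool
  shape m = twoPrefix m (stripOne a v)

r-side : ∀ b n j → count (λ w → exc w ≡ᵇ j) (Rep b (suc n)) ≡ shapeCount b one n j + shapeCount b two n j
r-side b n j = begin
    count (λ w → exc w ≡ᵇ j) (Rep b (suc n))
  ≡⟨ count-filter _ _ (allWords (suc n)) ⟩
    wordCount (suc n) excTest
  ≡⟨ wordCount-suc n excTest ⟩
    wordCount n (excTest ∘ (one ∷_)) + wordCount n (excTest ∘ (two ∷_))
  ≡⟨ cong₂ _+_ (wordCount-cong n {excTest ∘ (one ∷_)} {shapeTest b one j} (r-test′ one))
               (wordCount-cong n {excTest ∘ (two ∷_)} {shapeTest b two j} (r-test′ two)) ⟩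
    shapeCount b one n j + shapeCount b two n j ∎
  where
  open ≡-Reasoning
  excTest : List Letter → Bool
  excTest ω = rOK b (suc n) ω ∧ (excPairs ω (sortL ω) ≡ᵇ j)
  r-test′ : ∀ a (w : Vec Letter n) → excTest (a ∷ toList w) ≡ shapeTest b a j (toList w)
  r-test′ a w = subst (λ m → rOK b (suc m) (a ∷ toList w) ∧ (exc (a ∷ w) ≡ᵇ j) ≡ shapeTest b a j (toList w))
                      (length-toList w) (r-test b a j (toList w))

eulerian : ∀ b n → EulerianPair (Fib b (suc n)) (Rep b (suc n))
eulerian b n j = trans (fib-side b n j) (sym (r-side b n j))

theorem2p1 : (n : ℕ) → 1 ≤ n → EulerianPair (F n) (R n) × EulerianPair (F' n) (R' n)
theorem2p1 (suc n) _ = eulerian false n , eulerian true n
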